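{- Let $p$ be an odd prime and $\mathbf{C}^{(p)}=(c_i)_{i\ge0}$ the $p$-Cantor sequence. For every nonnegative integer $h$ and every $p^h\le i\le 2p^h-1$, $c_i=0$.
   Context: $p_2=(p-1)/2$. For real $a,b$, $\binom{a}{b}=\frac{a!}{b!(a-b)!}$ if $a,b$ are nonnegative integers with $a\ge b$, and $0$ otherwise. The $p$-Cantor sequence: let $\phi_p$ be the substitution on $\{0,1,\dots,p-1\}$ (identified with $\mathbb{F}_p$) sending each letter $n$ to the length-$p$ word whose $i$-th letter ($0\le i\le p-1$) is $n\binom{p_2}{i/2}\bmod p$, extended to words by concatenation; $\mathbf{C}^{(p)}=(c_i)_{i\ge0}=\lim_{k\to\infty}\phi_p^k(1)$. -}

module Defs where

open import Data.Nat using (ℕ; zero; suc; _+_; _*_; _/_; _%_; _^_; _∸_)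
open import Data.Nat.Combinatorics using (_C_)
open import Data.List using (List; []; _∷_; concatMap; map)
open import Data.List.Base using (upTo)

modp : ℕ → ℕ → ℕ
modp zero    x = x
modp (suc q) x = x % suc q

-- binom(p₂, i/2) with the paper's convention: 0 if i/2 is not an integer
-- (i odd); for i even, binom(p₂, i/2) (stdlib's _C_ is 0 when i/2 > p₂).
halfBinom : ℕ → ℕ → ℕ
halfBinom p i with i % 2
... | zero  = ((p ∸ 1) / 2) C (i / 2)
... | suc _ = 0

φletter : ℕ → ℕ → List ℕ
φletter p n = map (λ i → modp p (n * halfBinom p i)) (upTo p)

φ : ℕ → List ℕ → List ℕ
φ p = concatMap (φletter p)

φIter : ℕ → ℕ → List ℕ
φIter p zero    = 1 ∷ []
φIter p (suc k) = φ p (φIter p k)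

-- total list indexing (default 0 out of range; never used out of range below)
nth : List ℕ → ℕ → ℕ
nth []       _       = 0
nth (x ∷ xs) zero    = x
nth (x ∷ xs) (suc i) = nth xs i

-- c_i of C^(p) = lim_k φ_p^k(1): φ_p^k(1) is a prefix of φ_p^{k+1}(1) and has
-- length p^k > i for k = i+1 (p ≥ 2), so c_i is the i-th letter of φ_p^{i+1}(1).
cantor : ℕ → ℕ → ℕ
cantor p i = nth (φIter p (suc i)) i

{-# OPTIONS --safe #-}
module Submission where

-- Since φ_p maps each letter to a word of length p, the letter of φ_p^{k+1}(1)
-- at position i is determined by the letter of φ_p^k(1) at position i / p and
-- the digit i % p: it is c_{i/p} · binom(p₂, (i % p)/2) mod p. If i lies in
-- [p^{h+1}, 2p^{h+1}) then i / p lies in [p^h, 2p^h), so descending h times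
-- reduces the claim to c_1 = c_0 · binom(p₂, 1/2) = 0, as 1 is odd.

open import Defs
open import Data.Nat using (ℕ; _*_; _^_; _≤_; _<_; _%_)
open import Data.Nat.Primality using (Prime)
open import Relation.Binary.PropositionalEquality using (_≡_)

open import Data.Nat
  using (zero; suc; _+_; _/_; s≤s; z≤n; z<s; NonZero; NonTrivial; nonTrivial⇒nonZero; nonTrivial⇒n>1)
open import Data.Nat.Properties
open import Data.Nat.DivMod
open import Data.Nat.Primality using (prime⇒nonTrivial)
open import Data.List using ([]; _∷_; _++_; length; applyUpTo; upTo)
open import Data.List.Properties using (length-++; length-map; length-upTo; map-applyUpTo)
open import Relation.Binary.PropositionalEquality
  using (refl; sym; trans; cong; cong₂; subst; module ≡-Reasoning)
open import Relation.Nullary using (contradiction)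
open ≡-Reasoning

nth-++ˡ : ∀ xs ys {i} → i < length xs → nth (xs ++ ys) i ≡ nth xs i
nth-++ˡ (x ∷ xs) ys {zero}  _         = refl
nth-++ˡ (x ∷ xs) ys {suc i} (s≤s i<n) = nth-++ˡ xs ys i<n

nth-++ʳ : ∀ xs ys i → nth (xs ++ ys) (length xs + i) ≡ nth ys i
nth-++ʳ []       ys i = refl
nth-++ʳ (x ∷ xs) ys i = nth-++ʳ xs ys i

nth-applyUpTo : ∀ f {n i} → i < n → nth (applyUpTo f n) i ≡ f i
nth-applyUpTo f {suc n} {zero}  _         = refl
nth-applyUpTo f {suc n} {suc i} (s≤s i<n) = nth-applyUpTo (λ k → f (suc k)) i<n

modp-0 : ∀ p → modp p 0 ≡ 0
modp-0 zero    = refl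
modp-0 (suc p) = refl

halfBinom-odd : ∀ p {j} → j % 2 ≡ 1 → halfBinom p j ≡ 0
halfBinom-odd p odd rewrite odd = refl

length-φletter : ∀ p n → length (φletter p n) ≡ p
length-φletter p n = trans (length-map _ (upTo p)) (length-upTo p)

length-φ : ∀ p xs → length (φ p xs) ≡ length xs * p
length-φ p []       = refl
length-φ p (x ∷ xs) = begin
  length (φletter p x ++ φ p xs)         ≡⟨ length-++ (φletter p x) ⟩
  length (φletter p x) + length (φ p xs) ≡⟨ cong₂ _+_ (length-φletter p x) (length-φ p xs) ⟩
  p + length xs * p                      ∎

length-φIter : ∀ p k → length (φIter p k) ≡ p ^ k
length-φIter p zero    = refl
length-φIter p (suc k) = begin
  length (φ p (φIter p k)) ≡⟨ length-φ p (φIter p k) ⟩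
  length (φIter p k) * p   ≡⟨ cong (_* p) (length-φIter p k) ⟩
  p ^ k * p                ≡⟨ *-comm (p ^ k) p ⟩
  p ^ suc k                ∎

nth-φletter : ∀ p n {j} → j < p → nth (φletter p n) j ≡ modp p (n * halfBinom p j)
nth-φletter p n {j} j<p = begin
  nth (φletter p n) j         ≡⟨ cong (λ w → nth w j) (map-applyUpTo (λ i → i) letter p) ⟩
  nth (applyUpTo letter p) j  ≡⟨ nth-applyUpTo letter j<p ⟩
  modp p (n * halfBinom p j)  ∎
  where
  letter : ℕ → ℕ
  letter i = modp p (n * halfBinom p i)

nth-φ : ∀ p xs {n j} → n < length xs → j < p →
        nth (φ p xs) (n * p + j) ≡ nth (φletter p (nth xs n)) j
nth-φ p (x ∷ xs) {zero}  {j} _ j<p =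
  nth-++ˡ (φletter p x) (φ p xs) (subst (j <_) (sym (length-φletter p x)) j<p)
nth-φ p (x ∷ xs) {suc n} {j} (s≤s n<len) j<p = begin
  nth (φletter p x ++ φ p xs) (p + n * p + j)                    ≡⟨ cong (nth (φletter p x ++ φ p xs)) (+-assoc p (n * p) j) ⟩
  nth (φletter p x ++ φ p xs) (p + (n * p + j))                  ≡⟨ cong (λ l → nth (φletter p x ++ φ p xs) (l + (n * p + j)))
                                                                      (sym (length-φletter p x)) ⟩
  nth (φletter p x ++ φ p xs) (length (φletter p x) + (n * p + j)) ≡⟨ nth-++ʳ (φletter p x) (φ p xs) (n * p + j) ⟩
  nth (φ p xs) (n * p + j)                                       ≡⟨ nth-φ p xs n<len j<p ⟩
  nth (φletter p (nth xs n)) j                                   ∎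

module _ (p : ℕ) .{{_ : NonTrivial p}} where

  private instance
    p≢0 : NonZero p
    p≢0 = nonTrivial⇒nonZero p

  n<p^n : ∀ n → n < p ^ n
  n<p^n zero    = z<s
  n<p^n (suc n) = subst (suc n <_) (*-comm (p ^ n) p)
                         (≤-<-trans (n<p^n n) (m<m*n (p ^ n) p (nonTrivial⇒n>1 p)))
    where instance _ = m^n≢0 p n

  nth-φIter-suc : ∀ k {i} → i < p ^ suc k →
                  nth (φIter p (suc k)) i ≡ modp p (nth (φIter p k) (i / p) * halfBinom p (i % p))
  nth-φIter-suc k {i} i<p^k+1 = begin
    nth (φ p (φIter p k)) i                                ≡⟨ cong (nth (φ p (φIter p k))) i≡i/p*p+i%p ⟩
    nth (φ p (φIter p k)) (i / p * p + i % p)              ≡⟨ nth-φ p (φIter p k) i/p<length (m%n<n i p) ⟩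
    nth (φletter p (nth (φIter p k) (i / p))) (i % p)      ≡⟨ nth-φletter p (nth (φIter p k) (i / p)) (m%n<n i p) ⟩
    modp p (nth (φIter p k) (i / p) * halfBinom p (i % p)) ∎
    where
    i≡i/p*p+i%p : i ≡ i / p * p + i % p
    i≡i/p*p+i%p = trans (m≡m%n+[m/n]*n i p) (+-comm (i % p) (i / p * p))
    i/p<length : i / p < length (φIter p k)
    i/p<length = subst (i / p <_) (sym (length-φIter p k))
                       (m<n*o⇒m/o<n (subst (i <_) (*-comm p (p ^ k)) i<p^k+1))

  φIter-vanishes : ∀ h k {i} → p ^ h ≤ i → i < 2 * p ^ h → i < p ^ k → nth (φIter p k) i ≡ 0
  φIter-vanishes h zero lo _ (s≤s z≤n) = contradiction lo (<⇒≱ (m^n>0 p h))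
  φIter-vanishes zero (suc k) (s≤s z≤n) (s≤s (s≤s z≤n)) lt = begin
    nth (φIter p (suc k)) 1                                ≡⟨ nth-φIter-suc k lt ⟩
    modp p (nth (φIter p k) (1 / p) * halfBinom p (1 % p)) ≡⟨ cong (λ b → modp p (nth (φIter p k) (1 / p) * b))
                                                                 (halfBinom-odd p {1 % p} 1%p%2≡1) ⟩
    modp p (nth (φIter p k) (1 / p) * 0)                   ≡⟨ cong (modp p) (*-zeroʳ (nth (φIter p k) (1 / p))) ⟩
    modp p 0                                               ≡⟨ modp-0 p ⟩
    0                                                      ∎
    where
    1%p%2≡1 : 1 % p % 2 ≡ 1
    1%p%2≡1 = cong (_% 2) (m<n⇒m%n≡m (nonTrivial⇒n>1 p))
  φIter-vanishes (suc h) (suc k) {i} lo hi lt = begin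
    nth (φIter p (suc k)) i                                ≡⟨ nth-φIter-suc k lt ⟩
    modp p (nth (φIter p k) (i / p) * halfBinom p (i % p)) ≡⟨ cong (λ c → modp p (c * halfBinom p (i % p)))
                                                                 (φIter-vanishes h k lo′ hi′ lt′) ⟩
    modp p 0                                               ≡⟨ modp-0 p ⟩
    0                                                      ∎
    where
    lo′ : p ^ h ≤ i / p
    lo′ = subst (_≤ i / p) (m*n/n≡m (p ^ h) p) (/-monoˡ-≤ p (subst (_≤ i) (*-comm p (p ^ h)) lo))
    hi′ : i / p < 2 * p ^ h
    hi′ = m<n*o⇒m/o<n (subst (i <_) (trans (cong (2 *_) (*-comm p (p ^ h))) (sym (*-assoc 2 (p ^ h) p))) hi)
    lt′ : i / p < p ^ k
    lt′ = m<n*o⇒m/o<n (subst (i <_) (*-comm p (p ^ k)) lt)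

corollary3p6 : (p : ℕ) → Prime p → p % 2 ≡ 1 →
    (h i : ℕ) → p ^ h ≤ i → i < 2 * p ^ h → cantor p i ≡ 0
corollary3p6 p p-prime _ h i lo hi = φIter-vanishes p h (suc i) lo hi (<⇒≤ (n<p^n p (suc i)))
  where instance _ = prime⇒nonTrivial p-prime
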